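{- For every positive integer $r$, there exist an integer $K_r\le 3^r$, a linear equation $C(x_1,\dots,x_{K_r}) = a_1^{x_1}a_2^{x_2}\cdots a_{K_r}^{x_{K_r}}$ with coefficients $a_1,\dots,a_{K_r}\in\mathbf{D}_3$, and a map $\pi:\{x_1,\dots,x_{K_r}\}\to\{y_1,\dots,y_r\}$ such that for all $y\in\{0,1\}^r$, $\mathbf{1}[C(\pi(x_1),\dots,\pi(x_{K_r}))\neq 1] = \mathrm{AND}_r(y_1,\dots,y_r)$, where $C(\pi(x_1),\dots,\pi(x_{K_r}))$ means $C$ evaluated with each $x_i$ replaced by the value of the variable $\pi(x_i)$.
   Context: $\mathbf{D}_3$ is the dihedral group of order 6, with identity $1$. Variables $x_i$ take values in $\{0,1\}$, and $a^{0}=1$, $a^{1}=a$. $\mathrm{AND}_r(y_1,\dots,y_r)=1$ iff all $y_i=1$. -}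

module Defs where

open import Data.Nat using (ℕ; zero; suc)
open import Data.Fin using (Fin; zero; suc)
open import Data.Bool using (Bool; true; false; _xor_; _∧_; not)
open import Data.Product using (_×_; _,_)
open import Relation.Nullary using (Dec; yes; no)
open import Relation.Nullary.Decidable using (⌊_⌋)

data Z3 : Set where
  z0 z1 z2 : Z3

_+₃_ : Z3 → Z3 → Z3
z0 +₃ b = b
z1 +₃ z0 = z1
z1 +₃ z1 = z2
z1 +₃ z2 = z0
z2 +₃ z0 = z2
z2 +₃ z1 = z0
z2 +₃ z2 = z1

neg₃ : Z3 → Z3
neg₃ z0 = z0
neg₃ z1 = z2
neg₃ z2 = z1

-- The dihedral group D3 = Z/3 ⋊ Z/2 : the pair (i , s) denotes ρ^i σ^s,
-- with σ ρ σ⁻¹ = ρ⁻¹.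
D3 : Set
D3 = Z3 × Bool

_·_ : D3 → D3 → D3
(i , false) · (j , t) = (i +₃ j , t)
(i , true)  · (j , t) = (i +₃ neg₃ j , not t)

one : D3
one = (z0 , false)

isOne : D3 → Bool
isOne (z0 , false) = true
isOne _ = false

pow : D3 → Bool → D3
pow a false = one
pow a true  = a

evalEq : (K : ℕ) → (Fin K → D3) → (Fin K → Bool) → D3
evalEq zero    a x = one
evalEq (suc K) a x = pow (a zero) (x zero) · evalEq K (λ i → a (suc i)) (λ i → x (suc i))

AND : (r : ℕ) → (Fin r → Bool) → Bool
AND zero    y = true
AND (suc r) y = y zero ∧ AND r (λ i → y (suc i))

-- For a rotation e of D₃ one has e³ = 1 and σeσ = e⁻¹, so e σ^b e σ^b e equals e when b = 1
-- and 1 when b = 0: multiplying in one more variable costs three copies of the old equation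
-- and two reflections.  Starting from ρ^{y₁}, induction gives an equation of length < 3^r
-- that evaluates to ρ^{y₁ ∧ ⋯ ∧ y_r}, which is the identity exactly when the AND is false.
module Submission where

open import Defs
open import Data.Nat using (ℕ; zero; suc; _+_; _*_; _^_; _≤_; _<_; NonZero; s≤s; z≤n)
open import Data.Nat.Properties using (+-identityʳ; *-monoʳ-≤; <⇒≤; module ≤-Reasoning)
open import Data.Fin using (Fin; zero; suc)
open import Data.Bool using (Bool; true; false; not; _∧_)
open import Data.Bool.Properties using (not-involutive; ∧-identityʳ)
open import Data.Product using (Σ; _×_; ∃-syntax; _,_; proj₁; proj₂; map₂)
open import Data.Vec using (Vec; []; _∷_; _++_; map; lookup)
open import Function using (_∘_)
open import Relation.Binary.PropositionalEquality
  using (_≡_; refl; sym; trans; cong; cong₂; module ≡-Reasoning)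

+₃-identityʳ : ∀ a → a +₃ z0 ≡ a
+₃-identityʳ z0 = refl
+₃-identityʳ z1 = refl
+₃-identityʳ z2 = refl

+₃-assoc : ∀ a b c → (a +₃ b) +₃ c ≡ a +₃ (b +₃ c)
+₃-assoc z0 b  c  = refl
+₃-assoc z1 z0 c  = refl
+₃-assoc z2 z0 c  = refl
+₃-assoc a  b  z0 = trans (+₃-identityʳ (a +₃ b)) (cong (a +₃_) (sym (+₃-identityʳ b)))
+₃-assoc z1 z1 z1 = refl
+₃-assoc z1 z1 z2 = refl
+₃-assoc z1 z2 z1 = refl
+₃-assoc z1 z2 z2 = refl
+₃-assoc z2 z1 z1 = refl
+₃-assoc z2 z1 z2 = refl
+₃-assoc z2 z2 z1 = refl
+₃-assoc z2 z2 z2 = refl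

neg₃-involutive : ∀ a → neg₃ (neg₃ a) ≡ a
neg₃-involutive z0 = refl
neg₃-involutive z1 = refl
neg₃-involutive z2 = refl

neg₃-distrib-+₃ : ∀ a b → neg₃ (a +₃ b) ≡ neg₃ a +₃ neg₃ b
neg₃-distrib-+₃ z0 b  = refl
neg₃-distrib-+₃ z1 z0 = refl
neg₃-distrib-+₃ z1 z1 = refl
neg₃-distrib-+₃ z1 z2 = refl
neg₃-distrib-+₃ z2 z0 = refl
neg₃-distrib-+₃ z2 z1 = refl
neg₃-distrib-+₃ z2 z2 = refl

·-assoc : ∀ a b c → (a · b) · c ≡ a · (b · c)
·-assoc (i , false) (j , false) (k , u) = cong (_, u) (+₃-assoc i j k)
·-assoc (i , false) (j , true)  (k , u) = cong (_, not u) (+₃-assoc i j (neg₃ k))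
·-assoc (i , true)  (j , false) (k , u) = cong (_, not u) (begin
  (i +₃ neg₃ j) +₃ neg₃ k   ≡⟨ +₃-assoc i (neg₃ j) (neg₃ k) ⟩
  i +₃ (neg₃ j +₃ neg₃ k)   ≡⟨ cong (i +₃_) (sym (neg₃-distrib-+₃ j k)) ⟩
  i +₃ neg₃ (j +₃ k)        ∎)
  where open ≡-Reasoning
·-assoc (i , true)  (j , true)  (k , u) = cong₂ _,_ (begin
  (i +₃ neg₃ j) +₃ k              ≡⟨ +₃-assoc i (neg₃ j) k ⟩
  i +₃ (neg₃ j +₃ k)              ≡⟨ cong (λ m → i +₃ (neg₃ j +₃ m)) (sym (neg₃-involutive k)) ⟩
  i +₃ (neg₃ j +₃ neg₃ (neg₃ k))  ≡⟨ cong (i +₃_) (sym (neg₃-distrib-+₃ j (neg₃ k))) ⟩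
  i +₃ neg₃ (j +₃ neg₃ k)         ∎) (sym (not-involutive u))
  where open ≡-Reasoning

·-identityʳ : ∀ a → a · one ≡ a
·-identityʳ (i , false) = cong (_, false) (+₃-identityʳ i)
·-identityʳ (i , true)  = cong (_, true) (+₃-identityʳ i)

ρ σ : D3
ρ = (z1 , false)
σ = (z0 , true)

-- The case b = true is ρ^A σ ρ^A σ ρ^A = ρ^A ρ^{-A} ρ^A, the case b = false is ρ^{3A} = 1.
and-gadget : ∀ A b →
  pow ρ A · (pow σ b · (pow ρ A · (pow σ b · pow ρ A))) ≡ pow ρ (b ∧ A)
and-gadget false false = refl
and-gadget false true  = refl
and-gadget true  false = refl
and-gadget true  true  = refl

not-isOne-pow-ρ : ∀ A → not (isOne (pow ρ A)) ≡ A
not-isOne-pow-ρ false = refl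
not-isOne-pow-ρ true  = refl

-- A word w encodes the equation ∏ₖ aₖ^{x_{π k}} with (aₖ , π k) = lookup w k.
Word : ℕ → ℕ → Set
Word r K = Vec (D3 × Fin r) K

⟦_⟧ : ∀ {r K} → Word r K → (Fin r → Bool) → D3
⟦ w ⟧ y = evalEq _ (proj₁ ∘ lookup w) (y ∘ proj₂ ∘ lookup w)

⟦⟧-++ : ∀ {r K M} (u : Word r K) (v : Word r M) y → ⟦ u ++ v ⟧ y ≡ ⟦ u ⟧ y · ⟦ v ⟧ y
⟦⟧-++ []            v y = refl
⟦⟧-++ ((a , i) ∷ u) v y = trans (cong (pow a (y i) ·_) (⟦⟧-++ u v y))
                                (sym (·-assoc (pow a (y i)) (⟦ u ⟧ y) (⟦ v ⟧ y)))

⟦⟧-rename : ∀ {r s K} (f : Fin r → Fin s) (w : Word r K) y →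
  ⟦ map (map₂ f) w ⟧ y ≡ ⟦ w ⟧ (y ∘ f)
⟦⟧-rename f []            y = refl
⟦⟧-rename f ((a , i) ∷ w) y = cong (pow a (y (f i)) ·_) (⟦⟧-rename f w y)

size : ℕ → ℕ
size zero    = 1
size (suc n) = size n + suc (size n + suc (size n))

andWord : (n : ℕ) → Word (suc n) (size n)
andWord zero    = (ρ , zero) ∷ []
andWord (suc n) = e ++ (σ , zero) ∷ e ++ (σ , zero) ∷ e
  where e = map (map₂ suc) (andWord n)

⟦andWord⟧ : ∀ n y → ⟦ andWord n ⟧ y ≡ pow ρ (AND (suc n) y)
⟦andWord⟧ zero    y = trans (·-identityʳ (pow ρ (y zero))) (cong (pow ρ) (sym (∧-identityʳ (y zero))))
⟦andWord⟧ (suc n) y = begin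
  ⟦ e ++ s ∷ e ++ s ∷ e ⟧ y                  ≡⟨ ⟦⟧-++ e (s ∷ e ++ s ∷ e) y ⟩
  ⟦ e ⟧ y · (σ^b · ⟦ e ++ s ∷ e ⟧ y)          ≡⟨ cong (λ t → ⟦ e ⟧ y · (σ^b · t)) (⟦⟧-++ e (s ∷ e) y) ⟩
  ⟦ e ⟧ y · (σ^b · (⟦ e ⟧ y · (σ^b · ⟦ e ⟧ y))) ≡⟨ cong (λ t → t · (σ^b · (t · (σ^b · t)))) ⟦e⟧ ⟩
  ρ^A · (σ^b · (ρ^A · (σ^b · ρ^A)))           ≡⟨ and-gadget (AND (suc n) (y ∘ suc)) (y zero) ⟩
  pow ρ (AND (suc (suc n)) y)                 ∎
  where
  open ≡-Reasoning
  e   = map (map₂ suc) (andWord n)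
  s   = (σ , zero)
  σ^b = pow σ (y zero)
  ρ^A = pow ρ (AND (suc n) (y ∘ suc))
  ⟦e⟧ : ⟦ e ⟧ y ≡ ρ^A
  ⟦e⟧ = trans (⟦⟧-rename suc (andWord n) y) (⟦andWord⟧ n (y ∘ suc))

size<3^ : ∀ n → size n < 3 ^ suc n
size<3^ zero    = s≤s (s≤s z≤n)
size<3^ (suc n) = begin
  suc (L + suc (L + suc L))       ≡⟨ cong (λ m → suc (L + suc (L + suc m))) (sym (+-identityʳ L)) ⟩
  3 * suc L                       ≤⟨ *-monoʳ-≤ 3 (size<3^ n) ⟩
  3 ^ suc (suc n)                 ∎
  where
  open ≤-Reasoning
  L = size n

claim3p2 : (r : ℕ) → .{{_ : NonZero r}} →
    ∃[ K ] (K ≤ 3 ^ r) × (Σ (Fin K → D3) λ a → Σ (Fin K → Fin r) λ π →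
      (y : Fin r → Bool) → not (isOne (evalEq K a (λ i → y (π i)))) ≡ AND r y)
claim3p2 (suc n) =
  size n , <⇒≤ (size<3^ n) , proj₁ ∘ lookup w , proj₂ ∘ lookup w ,
  λ y → trans (cong (not ∘ isOne) (⟦andWord⟧ n y)) (not-isOne-pow-ρ (AND (suc n) y))
  where w = andWord n
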